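{- Let $R$ be a commutative ring with unity and let $(G,\alpha)$ be an edge-labeled graph over $R$ such that $G$ is a finite tree. Then $(G,\alpha)$ has rank one if and only if every edge is labeled $(0)$.
   Context: An edge labeling of a graph $G=(V,E)$ over $R$ is a function $\alpha:E\to I(R)$ to the set of ideals of $R$. A spline on $(G,\alpha)$ is a function $p:V\to R$ with $p(u)-p(v)\in\alpha(uv)$ for every edge $uv$. A constant spline takes the same value at every vertex. $(G,\alpha)$ has rank one if it admits only constant splines. -}

module Defs where

open import Level using (Level; _⊔_; suc)
open import Data.Nat using (ℕ)
open import Data.Fin using (Fin)
open import Data.List using (List; []; _∷_)
open import Data.List.Relation.Unary.Unique.Propositional using (Unique)
open import Data.Product using (Σ; ∃; _×_; _,_)
open import Relation.Binary.PropositionalEquality using (_≡_)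
open import Algebra.Bundles using (CommutativeRing)

-- A finite (multi)graph with vertex set Fin n and edge set Fin m;
-- each edge e has two endpoints  src e  and  tgt e  (orientation is irrelevant).
record Graph (n m : ℕ) : Set where
  field
    src : Fin m → Fin n
    tgt : Fin m → Fin n

module _ {n m : ℕ} (G : Graph n m) where
  open Graph G

  data Walk : Fin n → Fin n → List (Fin m) → Set where
    stop : ∀ {u} → Walk u u []
    fwd  : ∀ {v es} (e : Fin m) → Walk (tgt e) v es → Walk (src e) v (e ∷ es)
    bwd  : ∀ {v es} (e : Fin m) → Walk (src e) v es → Walk (tgt e) v (e ∷ es)

  Connected : Set
  Connected = ∀ u v → ∃ λ es → Walk u v es

  -- acyclic: there is no nonempty closed trail (closed walk without repeated edges)
  Acyclic : Set
  Acyclic = ∀ u es → Walk u u es → Unique es → es ≡ []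

  IsTree : Set
  IsTree = Connected × Acyclic

module _ {c ℓ : Level} (R : CommutativeRing c ℓ) where
  open CommutativeRing R

  record Ideal : Set (c ⊔ suc ℓ) where
    field
      _∈I        : Carrier → Set ℓ
      ∈-resp-≈   : ∀ {x y} → x ≈ y → x ∈I → y ∈I
      0∈I        : 0# ∈I
      +-closed   : ∀ {x y} → x ∈I → y ∈I → (x + y) ∈I
      *-closed   : ∀ r {x} → x ∈I → (r * x) ∈I

  IsZeroIdeal : Ideal → Set (c ⊔ ℓ)
  IsZeroIdeal I = ∀ x → ((x ∈I) → x ≈ 0#) × (x ≈ 0# → (x ∈I))
    where open Ideal I

  module _ {n m : ℕ} (G : Graph n m) where
    open Graph G

    EdgeLabeling : Set (c ⊔ suc ℓ)
    EdgeLabeling = Fin m → Ideal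

    IsSpline : EdgeLabeling → (Fin n → Carrier) → Set ℓ
    IsSpline α p = ∀ e → Ideal._∈I (α e) (p (src e) - p (tgt e))

    IsConstant : (Fin n → Carrier) → Set ℓ
    IsConstant p = ∀ u v → p u ≈ p v

    RankOne : EdgeLabeling → Set (c ⊔ ℓ)
    RankOne α = ∀ (p : Fin n → Carrier) → IsSpline α p → IsConstant p

-- A spline whose differences vanish on every edge is constant along walks,
-- hence constant on a connected graph. Conversely, removing an edge e from a
-- tree splits its vertices into the side of  src e  and the side of  tgt e
-- (two sides, by connectivity; disjoint, since an e-avoiding walk between
-- them would close a cycle through e). For x ∈ α e, the function that is x
-- on the  tgt e  side and 0 on the other is a spline, so rank one forces
-- x ≈ 0.
module Submission where

open import Defs
open import Level using (Level)
open import Data.Nat using (ℕ)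
open import Data.Fin using (Fin; _≟_)
open import Data.Bool using (Bool; true; false)
open import Data.List using ([]; _∷_)
open import Data.List.Relation.Unary.All as All using (All; []; _∷_)
open import Data.List.Relation.Unary.AllPairs using ([]; _∷_)
open import Data.List.Relation.Unary.Unique.Propositional using (Unique)
open import Data.Product using (Σ; ∃; _×_; _,_; proj₁; proj₂)
open import Data.Sum using (_⊎_; inj₁; inj₂)
open import Data.Empty using (⊥-elim)
open import Data.Unit using (⊤; tt)
open import Function using (_∘_)
open import Function.Bundles using (_⇔_; mk⇔)
open import Relation.Nullary using (¬_; Dec; yes; no)
open import Relation.Nullary.Decidable using (_⊎-dec_)
open import Relation.Binary.Bundles using (Setoid)
open import Relation.Binary.PropositionalEquality
  using (_≡_; _≢_; refl; sym; cong; subst; ≢-sym)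
open import Algebra.Bundles using (CommutativeRing)
import Algebra.Properties.Ring as RingProperties
import Algebra.Properties.Group as GroupProperties

module _ {n m : ℕ} (G : Graph n m) where
  open Graph G

  walk-respects : ∀ {c ℓ} (S : Setoid c ℓ) (p : Fin n → Setoid.Carrier S) →
                  (∀ f → Setoid._≈_ S (p (src f)) (p (tgt f))) →
                  ∀ {a b es} → Walk G a b es → Setoid._≈_ S (p a) (p b)
  walk-respects S p edge stop      = Setoid.refl S
  walk-respects S p edge (fwd f w) = Setoid.trans S (edge f) (walk-respects S p edge w)
  walk-respects S p edge (bwd f w) =
    Setoid.trans S (Setoid.sym S (edge f)) (walk-respects S p edge w)

  infix 4 _∈ᵥ_ _∈ᵥ?_

  _∈ᵥ_ : Fin n → ∀ {a b es} → Walk G a b es → Set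
  x ∈ᵥ (stop {u}) = x ≡ u
  x ∈ᵥ fwd e w    = x ≡ src e ⊎ x ∈ᵥ w
  x ∈ᵥ bwd e w    = x ≡ tgt e ⊎ x ∈ᵥ w

  _∈ᵥ?_ : ∀ x {a b es} (w : Walk G a b es) → Dec (x ∈ᵥ w)
  x ∈ᵥ? (stop {u}) = x ≟ u
  x ∈ᵥ? fwd e w    = (x ≟ src e) ⊎-dec (x ∈ᵥ? w)
  x ∈ᵥ? bwd e w    = (x ≟ tgt e) ⊎-dec (x ∈ᵥ? w)

  start∈ᵥ : ∀ {a b es} (w : Walk G a b es) → a ∈ᵥ w
  start∈ᵥ stop      = refl
  start∈ᵥ (fwd e w) = inj₁ refl
  start∈ᵥ (bwd e w) = inj₁ refl

  IsPath : ∀ {a b es} → Walk G a b es → Set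
  IsPath stop      = ⊤
  IsPath (fwd e w) = ¬ (src e ∈ᵥ w) × IsPath w
  IsPath (bwd e w) = ¬ (tgt e ∈ᵥ w) × IsPath w

  data PathWith (P : Fin m → Set) (a b : Fin n) : Set where
    path : ∀ {es} (w : Walk G a b es) → IsPath w → All P es → PathWith P a b

  suffixFrom : ∀ {P} x {a b es} (w : Walk G a b es) →
               x ∈ᵥ w → IsPath w → All P es → PathWith P x b
  suffixFrom x stop      refl        _            _         = path stop tt []
  suffixFrom x (fwd e w) (inj₁ refl) isPath       Pes       = path (fwd e w) isPath Pes
  suffixFrom x (fwd e w) (inj₂ x∈w)  (_ , isPath) (_ ∷ Pes) = suffixFrom x w x∈w isPath Pes
  suffixFrom x (bwd e w) (inj₁ refl) isPath       Pes       = path (bwd e w) isPath Pes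
  suffixFrom x (bwd e w) (inj₂ x∈w)  (_ , isPath) (_ ∷ Pes) = suffixFrom x w x∈w isPath Pes

  -- Loops are cut out at the first repeated vertex, so only edges of the
  -- original walk survive and every property of them is kept.
  shorten : ∀ {P a b es} → Walk G a b es → All P es → PathWith P a b
  shorten stop [] = path stop tt []
  shorten (fwd e w) (Pe ∷ Pes) with shorten w Pes
  ... | path w′ isPath Pes′ with src e ∈ᵥ? w′
  ...   | yes s∈w′ = suffixFrom (src e) w′ s∈w′ isPath Pes′
  ...   | no  s∉w′ = path (fwd e w′) (s∉w′ , isPath) (Pe ∷ Pes′)
  shorten (bwd e w) (Pe ∷ Pes) with shorten w Pes
  ... | path w′ isPath Pes′ with tgt e ∈ᵥ? w′
  ...   | yes t∈w′ = suffixFrom (tgt e) w′ t∈w′ isPath Pes′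
  ...   | no  t∉w′ = path (bwd e w′) (t∉w′ , isPath) (Pe ∷ Pes′)

  ∉ᵥ⇒edges-miss : ∀ y {a b es} (w : Walk G a b es) → ¬ (y ∈ᵥ w) →
                  All (λ f → src f ≢ y × tgt f ≢ y) es
  ∉ᵥ⇒edges-miss y stop _ = []
  ∉ᵥ⇒edges-miss y (fwd e w) y∉ =
    (y∉ ∘ inj₁ ∘ sym , y∉ ∘ inj₂ ∘ λ t≡y → subst (_∈ᵥ w) t≡y (start∈ᵥ w))
    ∷ ∉ᵥ⇒edges-miss y w (y∉ ∘ inj₂)
  ∉ᵥ⇒edges-miss y (bwd e w) y∉ =
    (y∉ ∘ inj₂ ∘ (λ s≡y → subst (_∈ᵥ w) s≡y (start∈ᵥ w)) , y∉ ∘ inj₁ ∘ sym)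
    ∷ ∉ᵥ⇒edges-miss y w (y∉ ∘ inj₂)

  IsPath⇒Unique : ∀ {a b es} (w : Walk G a b es) → IsPath w → Unique es
  IsPath⇒Unique stop _ = []
  IsPath⇒Unique (fwd e w) (s∉w , isPath) =
    All.map (λ miss e≡f → proj₁ miss (sym (cong src e≡f))) (∉ᵥ⇒edges-miss (src e) w s∉w)
    ∷ IsPath⇒Unique w isPath
  IsPath⇒Unique (bwd e w) (t∉w , isPath) =
    All.map (λ miss e≡f → proj₂ miss (sym (cong tgt e≡f))) (∉ᵥ⇒edges-miss (tgt e) w t∉w)
    ∷ IsPath⇒Unique w isPath

  module _ (e : Fin m) where

    data Avoiding : Fin n → Fin n → Set where
      stop : ∀ {u} → Avoiding u u
      fwd  : ∀ {v} f → f ≢ e → Avoiding (tgt f) v → Avoiding (src f) v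
      bwd  : ∀ {v} f → f ≢ e → Avoiding (src f) v → Avoiding (tgt f) v

  module _ {e : Fin m} where

    _++ᵃ_ : ∀ {a b c} → Avoiding e a b → Avoiding e b c → Avoiding e a c
    stop        ++ᵃ q = q
    fwd f f≢e p ++ᵃ q = fwd f f≢e (p ++ᵃ q)
    bwd f f≢e p ++ᵃ q = bwd f f≢e (p ++ᵃ q)

    reverseᵃ : ∀ {a b} → Avoiding e a b → Avoiding e b a
    reverseᵃ stop          = stop
    reverseᵃ (fwd f f≢e p) = reverseᵃ p ++ᵃ bwd f f≢e stop
    reverseᵃ (bwd f f≢e p) = reverseᵃ p ++ᵃ fwd f f≢e stop

    Avoiding⇒Walk : ∀ {a b} → Avoiding e a b → ∃ λ es → Walk G a b es × All (_≢ e) es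
    Avoiding⇒Walk stop = [] , stop , []
    Avoiding⇒Walk (fwd f f≢e p) with Avoiding⇒Walk p
    ... | es , w , ≢es = f ∷ es , fwd f w , f≢e ∷ ≢es
    Avoiding⇒Walk (bwd f f≢e p) with Avoiding⇒Walk p
    ... | es , w , ≢es = f ∷ es , bwd f w , f≢e ∷ ≢es

  module _ (e : Fin m) where

    -- An e-avoiding walk from  tgt e  to  src e, shortened to a path and
    -- preceded by e, is a nonempty closed trail.
    acyclic⇒¬detour : Acyclic G → ¬ Avoiding e (tgt e) (src e)
    acyclic⇒¬detour acyclic d with Avoiding⇒Walk d
    ... | _ , w , ≢es with shorten w ≢es
    ... | path w′ isPath ≢es′
      with acyclic (src e) _ (fwd e w′) (All.map ≢-sym ≢es′ ∷ IsPath⇒Unique w′ isPath)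
    ... | ()

    -- The suffix after the last traversal of e, if any.
    avoiding-or-exit : ∀ {a b es} → Walk G a b es →
                       Avoiding e a b ⊎ Avoiding e (src e) b ⊎ Avoiding e (tgt e) b
    avoiding-or-exit stop = inj₁ stop
    avoiding-or-exit (fwd f w) with avoiding-or-exit w | f ≟ e
    ... | inj₂ exit | _        = inj₂ exit
    ... | inj₁ d    | yes refl = inj₂ (inj₂ d)
    ... | inj₁ d    | no f≢e   = inj₁ (fwd f f≢e d)
    avoiding-or-exit (bwd f w) with avoiding-or-exit w | f ≟ e
    ... | inj₂ exit | _        = inj₂ exit
    ... | inj₁ d    | yes refl = inj₂ (inj₁ d)
    ... | inj₁ d    | no f≢e   = inj₁ (bwd f f≢e d)

    Side : Fin n → Set
    Side v = Avoiding e (tgt e) v ⊎ Avoiding e (src e) v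

    connected⇒side : Connected G → ∀ v → Side v
    connected⇒side connected v with avoiding-or-exit (proj₂ (connected (tgt e) v))
    ... | inj₁ d        = inj₁ d
    ... | inj₂ (inj₁ d) = inj₂ d
    ... | inj₂ (inj₂ d) = inj₁ d

  record Separates (e : Fin m) (S : Fin n → Bool) : Set where
    field
      src-false : S (src e) ≡ false
      tgt-true  : S (tgt e) ≡ true
      uncut     : ∀ f → f ≢ e → S (src f) ≡ S (tgt f)

  tree⇒separating : IsTree G → ∀ e → Σ (Fin n → Bool) (Separates e)
  tree⇒separating (connected , acyclic) e = isTgtSide ∘ side , record
    { src-false = at-src (side (src e))
    ; tgt-true  = at-tgt (side (tgt e))
    ; uncut     = λ f f≢e → across f f≢e (side (src f)) (side (tgt f))
    }
    where
    side : ∀ v → Side e v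
    side = connected⇒side e connected

    isTgtSide : ∀ {v} → Side e v → Bool
    isTgtSide (inj₁ _) = true
    isTgtSide (inj₂ _) = false

    no-detour : ¬ Avoiding e (tgt e) (src e)
    no-detour = acyclic⇒¬detour e acyclic

    at-src : (s : Side e (src e)) → isTgtSide s ≡ false
    at-src (inj₁ d) = ⊥-elim (no-detour d)
    at-src (inj₂ _) = refl

    at-tgt : (s : Side e (tgt e)) → isTgtSide s ≡ true
    at-tgt (inj₁ _) = refl
    at-tgt (inj₂ d) = ⊥-elim (no-detour (reverseᵃ d))

    across : ∀ f → f ≢ e → (s : Side e (src f)) (s′ : Side e (tgt f)) →
             isTgtSide s ≡ isTgtSide s′
    across f f≢e (inj₁ _) (inj₁ _) = refl
    across f f≢e (inj₂ _) (inj₂ _) = refl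
    across f f≢e (inj₁ d) (inj₂ d′) =
      ⊥-elim (no-detour (d ++ᵃ fwd f f≢e (reverseᵃ d′)))
    across f f≢e (inj₂ d) (inj₁ d′) =
      ⊥-elim (no-detour (d′ ++ᵃ bwd f f≢e (reverseᵃ d)))

module _ {c ℓ : Level} (R : CommutativeRing c ℓ) where
  open CommutativeRing R renaming (refl to ≈-refl; sym to ≈-sym; trans to ≈-trans)
  open RingProperties ring using (-1*x≈-x)
  open GroupProperties +-group using (x∙y⁻¹≈ε⇒x≈y)

  module _ (I : Ideal R) where
    open Ideal I

    -‿closed : ∀ {x} → x ∈I → (- x) ∈I
    -‿closed {x} x∈I = ∈-resp-≈ (-1*x≈-x x) (*-closed (- 1#) x∈I)

    ≈⇒-∈ : ∀ {x y} → x ≈ y → (x - y) ∈I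
    ≈⇒-∈ {x} {y} x≈y =
      ∈-resp-≈ (≈-sym (≈-trans (+-congʳ x≈y) (-‿inverseʳ y))) 0∈I

  mark : Carrier → Bool → Carrier
  mark x true  = x
  mark x false = 0#

  module _ {n m : ℕ} (G : Graph n m) (α : EdgeLabeling R G) where
    open Graph G

    zero-labels⇒rankOne : Connected G → (∀ e → IsZeroIdeal R (α e)) → RankOne R G α
    zero-labels⇒rankOne connected zero p spline u v =
      walk-respects G setoid p edge≈ (proj₂ (connected u v))
      where
      edge≈ : ∀ f → p (src f) ≈ p (tgt f)
      edge≈ f = x∙y⁻¹≈ε⇒x≈y _ _ (proj₁ (zero f _) (spline f))

    separated-spline : ∀ {e S x} → Separates G e S → Ideal._∈I (α e) x →
                       IsSpline R G α (mark x ∘ S)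
    separated-spline {e} {x = x} sep x∈αe f with f ≟ e
    ... | no f≢e rewrite Separates.uncut sep f f≢e = ≈⇒-∈ (α f) ≈-refl
    ... | yes refl rewrite Separates.src-false sep | Separates.tgt-true sep =
      Ideal.∈-resp-≈ (α e) (≈-sym (+-identityˡ (- x))) (-‿closed (α e) x∈αe)

    rankOne⇒zero-labels : (∀ e → Σ (Fin n → Bool) (Separates G e)) →
                          RankOne R G α → ∀ e → IsZeroIdeal R (α e)
    rankOne⇒zero-labels separating rankOne e x =
      only-zero (separating e) , λ x≈0 → ∈-resp-≈ (≈-sym x≈0) 0∈I
      where
      open Ideal (α e)
      only-zero : Σ (Fin n → Bool) (Separates G e) → x ∈I → x ≈ 0#
      only-zero (S , sep) x∈αe
        with rankOne (mark x ∘ S) (separated-spline sep x∈αe) (src e) (tgt e)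
      ... | ends≈ rewrite Separates.src-false sep | Separates.tgt-true sep = ≈-sym ends≈

corollary4p3 : ∀ {c ℓ : Level} (R : CommutativeRing c ℓ) {n m : ℕ} (G : Graph n m)
    → IsTree G → (α : EdgeLabeling R G)
    → RankOne R G α ⇔ (∀ (e : Fin m) → IsZeroIdeal R (α e))
corollary4p3 R G tree α =
  mk⇔ (rankOne⇒zero-labels R G α (tree⇒separating G tree))
      (zero-labels⇒rankOne R G α (proj₁ tree))
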